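{- Let $G$ be a graph without isolated vertices. Then $\partial\Gamma(G)=2$ if and only if either $G$ is isomorphic to the complete bipartite graph $K_{n,m}$ for some $n\ge2$ and $m\ge1$, or every connected component of $G$ is a single edge $K_2$.
   Context: A proper $k$-coloring of $G$ is a surjective map $c:V(G)\to\{1,\dots,k\}$ with $c(u)\ne c(v)$ for every edge $uv$. In a proper coloring, a vertex of color $i$ is a Grundy vertex if for every $j<i$ it has a neighbor of color $j$. A partial Grundy $k$-coloring is a proper $k$-coloring in which every color class contains at least one Grundy vertex; $\partial\Gamma(G)$ is the largest $k$ such that $G$ has a partial Grundy $k$-coloring. -}

module Defs where

open import Data.Nat using (ℕ; _+_; _≤_)
open import Data.Fin using (Fin; _<_; toℕ)
open import Data.Bool using (Bool; T; true; false; _≟_)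
open import Data.Product using (Σ; ∃; _×_; _,_)
open import Data.Sum using (_⊎_)
open import Relation.Binary.PropositionalEquality using (_≡_; _≢_)
open import Relation.Nullary using (¬_)
open import Relation.Binary.Construct.Closure.ReflexiveTransitive using (Star)
open import Function.Bundles using (_⤖_; Bijection)

record Graph : Set where
  field
    n      : ℕ
    adj    : Fin n → Fin n → Bool
    sym    : ∀ u v → adj u v ≡ adj v u
    irrefl : ∀ v → adj v v ≡ false

open Graph public

V : Graph → Set
V G = Fin (n G)

Adj : (G : Graph) → V G → V G → Set
Adj G u v = T (adj G u v)

NoIsolated : Graph → Set
NoIsolated G = ∀ v → ∃ λ u → Adj G v u

-- Colorings with k colours; colour i ∈ {1..k} is represented by Fin k (0-indexed).
Proper : (G : Graph) {k : ℕ} → (V G → Fin k) → Set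
Proper G c = ∀ u v → Adj G u v → c u ≢ c v

Surjective : (G : Graph) {k : ℕ} → (V G → Fin k) → Set
Surjective G {k} c = ∀ (i : Fin k) → ∃ λ v → c v ≡ i

GrundyVertex : (G : Graph) {k : ℕ} → (V G → Fin k) → V G → Set
GrundyVertex G {k} c v = ∀ (j : Fin k) → j < c v → ∃ λ u → Adj G v u × c u ≡ j

PartialGrundyColoring : (G : Graph) (k : ℕ) → (V G → Fin k) → Set
PartialGrundyColoring G k c =
  Surjective G c × Proper G c ×
  (∀ (i : Fin k) → ∃ λ v → c v ≡ i × GrundyVertex G c v)

HasPartialGrundy : Graph → ℕ → Set
HasPartialGrundy G k = ∃ λ (c : V G → Fin k) → PartialGrundyColoring G k c

PartialGrundyNumberIs : Graph → ℕ → Set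
PartialGrundyNumberIs G k =
  HasPartialGrundy G k × (∀ k' → HasPartialGrundy G k' → k' ≤ k)

-- complete bipartite graph K_{a,b} on Fin (a + b): first a vertices vs last b
side : ∀ {a b} → Fin (a + b) → Bool
side {a} u = Data.Nat._<ᵇ_ (toℕ u) a
  where import Data.Nat

CompleteBipartite : ℕ → ℕ → Graph
CompleteBipartite a b = record
  { n = a + b
  ; adj = λ u v → Data.Bool.not (Data.Bool._∧_ (side {a} {b} u) (side {a} {b} v))
                  Data.Bool.∧ Data.Bool.not (Data.Bool._∧_ (Data.Bool.not (side {a} {b} u)) (Data.Bool.not (side {a} {b} v)))
  ; sym = λ u v → symP (side {a} {b} u) (side {a} {b} v)
  ; irrefl = λ v → irrP (side {a} {b} v)
  }
  where
  import Data.Bool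
  open Data.Bool using (not; _∧_)
  open import Relation.Binary.PropositionalEquality using (refl)
  symP : ∀ x y → (not (x ∧ y) ∧ not (not x ∧ not y)) ≡ (not (y ∧ x) ∧ not (not y ∧ not x))
  symP true true = refl
  symP true false = refl
  symP false true = refl
  symP false false = refl
  irrP : ∀ x → (not (x ∧ x) ∧ not (not x ∧ not x)) ≡ false
  irrP true = refl
  irrP false = refl

_≅_ : Graph → Graph → Set
G ≅ H = Σ (V G ⤖ V H) λ f →
  ∀ u v → adj G u v ≡ adj H (Bijection.to f u) (Bijection.to f v)

Reach : (G : Graph) → V G → V G → Set
Reach G = Star (Adj G)

EveryComponentK2 : Graph → Set
EveryComponentK2 G = ∀ v → ∃ λ u → Adj G v u × (∀ w → Reach G v w → w ≡ v ⊎ w ≡ u)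

-- A partial Grundy 2-colouring is nothing but a bipartition together with an edge.  A third
-- colour needs a Grundy vertex v of colour 3 with neighbours x, y of colours 1 and 2: this is
-- impossible when every vertex has a single neighbour, and in a complete bipartite graph a
-- Grundy vertex u of colour 2 clashes with y (if u lies on v's side) or its neighbour of
-- colour 1 clashes with x (otherwise).  Conversely, fix the bipartition given by a partial
-- Grundy 2-colouring.  If no vertex has two neighbours, every component is an edge.  If v has
-- two neighbours x ≠ y and some w on v's side is not adjacent to x, then colouring x with 1,
-- the rest of x's side with 2, the neighbours of x with 3 and everything else with 1 makes x,
-- a neighbour of w, and v Grundy vertices, so ∂Γ ≥ 3.  Hence v's side is joined to every
-- neighbour of v, and then to every vertex of the other side: G is complete bipartite.

module Submission where

open import Defs
open import Data.Bool as Bool using (Bool; true; false; not; _∧_; _xor_; T)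
open import Data.Bool.Properties
  using (¬-not; xor-same; xor-comm; xor-identityʳ; xor-annihilates-not; xor-inverseˡ; T-≡; ⇔→≡)
open import Data.Empty using (⊥; ⊥-elim)
open import Data.Fin as Fin using (Fin; zero; suc; toℕ; fromℕ<; punchIn; cast)
open import Data.Fin.Patterns using (0F; 1F; 2F)
open import Data.Fin.Permutation using (Permutation; _⟨$⟩ʳ_; lift₀; insert; _∘ₚ_; cast-id)
import Data.Fin.Permutation as Permutation
open import Data.Fin.Properties using (toℕ-injective; toℕ-fromℕ<; toℕ-cast; toℕ<n; 0≢1+n; any?; 2↔Bool)
import Data.Fin.Properties as Fin
open import Data.Nat as ℕ using (ℕ; suc; zero; z≤n; s≤s; z<s; s<s; _+_; _≤_; _<ᵇ_; _≤?_)
open import Data.Nat.Properties using (+-suc; +-identityʳ; m≤m+n; ≤-trans; <ᵇ⇒<; <⇒<ᵇ; ≰⇒>)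
open import Data.Product using (∃; ∃₂; Σ; _×_; _,_; proj₁; proj₂)
open import Data.Sum as Sum using (_⊎_; inj₁; inj₂)
open import Data.Unit using (tt)
open import Function using (_∘_)
open import Function.Bundles using (_⇔_; mk⇔; Equivalence; Inverse; Bijection)
open import Function.Properties.Inverse using (↔⇒⤖)
open import Relation.Binary.Construct.Closure.ReflexiveTransitive using (ε; _◅_)
open import Relation.Binary.PropositionalEquality
  using (_≡_; _≢_; refl; trans; cong; cong₂; subst; subst₂)
import Relation.Binary.PropositionalEquality as ≡
open import Relation.Nullary using (¬_; Dec; yes; no; does)
open import Relation.Nullary.Decidable using (T?; dec-true; dec-false; _×-dec_; ¬?; decidable-stable)

not∧not-xor : ∀ x y → not (x ∧ y) ∧ not (not x ∧ not y) ≡ x xor y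
not∧not-xor true  true  = refl
not∧not-xor true  false = refl
not∧not-xor false true  = refl
not∧not-xor false false = refl

≢⇒xor≡true : ∀ {x y} → x ≢ y → x xor y ≡ true
≢⇒xor≡true {y = y} x≢y = trans (cong (_xor y) (¬-not x≢y)) (xor-inverseˡ y)

T-xor⇒≢ : ∀ {x y} → T (x xor y) → x ≢ y
T-xor⇒≢ {x} t refl = subst T (xor-same x) t

≢⇒T-xor : ∀ {x y} → x ≢ y → T (x xor y)
≢⇒T-xor x≢y = subst T (≡.sym (≢⇒xor≡true x≢y)) tt

xor-cancelʳ : ∀ x y z → (x xor z) xor (y xor z) ≡ x xor y
xor-cancelʳ x y false = cong₂ _xor_ (xor-identityʳ x) (xor-identityʳ y)
xor-cancelʳ x y true  = trans (cong₂ _xor_ (xor-comm x true) (xor-comm y true)) (xor-annihilates-not x y)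

≢-≢⇒≡ : ∀ {x y z : Bool} → x ≢ z → y ≢ z → x ≡ y
≢-≢⇒≡ x≢z y≢z = trans (¬-not x≢z) (≡.sym (¬-not y≢z))

<ᵇ-irrefl : ∀ n → (n <ᵇ n) ≡ false
<ᵇ-irrefl zero    = refl
<ᵇ-irrefl (suc n) = <ᵇ-irrefl n

≢⇒<ᵇ-flip : ∀ {m n} → m ≢ n → (m <ᵇ n) ≢ (n <ᵇ m)
≢⇒<ᵇ-flip {zero}  {zero}  m≢n = ⊥-elim (m≢n refl)
≢⇒<ᵇ-flip {zero}  {suc n} _   = λ ()
≢⇒<ᵇ-flip {suc m} {zero}  _   = λ ()
≢⇒<ᵇ-flip {suc m} {suc n} m≢n = ≢⇒<ᵇ-flip (m≢n ∘ cong suc)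

distinct-<⇒2≤ : ∀ {i j a} → i ℕ.< a → j ℕ.< a → i ≢ j → 2 ≤ a
distinct-<⇒2≤ {zero}  {zero}  _   _   i≢j = ⊥-elim (i≢j refl)
distinct-<⇒2≤ {zero}  {suc j} _   j<a _   = ≤-trans (s≤s (s≤s z≤n)) j<a
distinct-<⇒2≤ {suc i}         i<a _   _   = ≤-trans (s≤s (s≤s z≤n)) i<a

completeBipartite-adj : ∀ {a b} u v → adj (CompleteBipartite a b) u v ≡ side {a} {b} u xor side {a} {b} v
completeBipartite-adj {a} {b} u v = not∧not-xor (side {a} {b} u) (side {a} {b} v)

side≡true⇒< : ∀ {a b} (i : Fin (a + b)) → side {a} {b} i ≡ true → toℕ i ℕ.< a
side≡true⇒< {a} i e = <ᵇ⇒< (toℕ i) a (subst T (≡.sym e) tt)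

side≡false⇒1≤b : ∀ {a b} (i : Fin (a + b)) → side {a} {b} i ≡ false → 1 ≤ b
side≡false⇒1≤b {a} {zero}  i e =
  ⊥-elim (subst T e (<⇒<ᵇ (subst (toℕ i ℕ.<_) (+-identityʳ a) (toℕ<n i))))
side≡false⇒1≤b {b = suc b} _ _ = s≤s z≤n

toℕ-punchIn-<ᵇ : ∀ {n} (j : Fin (suc n)) k → (toℕ (punchIn j k) <ᵇ toℕ j) ≡ (toℕ k <ᵇ toℕ j)
toℕ-punchIn-<ᵇ zero    k       = refl
toℕ-punchIn-<ᵇ (suc j) zero    = refl
toℕ-punchIn-<ᵇ (suc j) (suc k) = toℕ-punchIn-<ᵇ j k

-- A new first element goes to position 0 if it is true and to position a, the bottom of the
-- second side, if it is false.
sortBySide : ∀ {m} (f : Fin m → Bool) →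
             ∃₂ λ a b → Σ (Permutation m (a + b)) λ π → ∀ i → side {a} {b} (π ⟨$⟩ʳ i) ≡ f i
sortBySide {zero}  f = 0 , 0 , Permutation.id , λ ()
sortBySide {suc m} f with sortBySide (f ∘ suc) | f zero in f0
... | a , b , π , sides | true  = suc a , b , lift₀ π , λ where
        zero    → ≡.sym f0
        (suc i) → sides i
... | a , b , π , sides | false = a , suc b , insert zero j π ∘ₚ cast-id (≡.sym (+-suc a b)) , λ where
        zero    → trans (side-cast j) (trans (cong (_<ᵇ a) toℕ-j) (trans (<ᵇ-irrefl a) (≡.sym f0)))
        (suc i) → trans (side-cast _) (trans (punchIn-side (π ⟨$⟩ʳ i)) (sides i))
  where
  j : Fin (suc (a + b))
  j = fromℕ< (s≤s (m≤m+n a b))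
  toℕ-j : toℕ j ≡ a
  toℕ-j = toℕ-fromℕ< (s≤s (m≤m+n a b))
  side-cast : ∀ k → side {a} {suc b} (cast (≡.sym (+-suc a b)) k) ≡ (toℕ k <ᵇ a)
  side-cast k = cong (_<ᵇ a) (toℕ-cast _ k)
  punchIn-side : ∀ k → (toℕ (punchIn j k) <ᵇ a) ≡ (toℕ k <ᵇ a)
  punchIn-side k = subst (λ t → (toℕ (punchIn j k) <ᵇ t) ≡ (toℕ k <ᵇ t)) toℕ-j (toℕ-punchIn-<ᵇ j k)

Bipartition : (G : Graph) → (V G → Bool) → Set
Bipartition G s = ∀ {u v} → Adj G u v → s u ≢ s v

record CompleteBipartition (G : Graph) (s : V G → Bool) : Set where
  constructor completeBipartition
  field adj≡xor : ∀ u v → adj G u v ≡ s u xor s v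

AtMostOneNeighbour : Graph → Set
AtMostOneNeighbour G = ∀ {v x y} → Adj G v x → Adj G v y → x ≡ y

module Properties {G : Graph} where

  adjSym : ∀ {u v} → Adj G u v → Adj G v u
  adjSym {u} {v} = subst T (Graph.sym G u v)

  adj⇒≢ : ∀ {u v} → Adj G u v → u ≢ v
  adj⇒≢ {u} uv refl = subst T (irrefl G u) uv

  module _ {s : V G → Bool} where

    completeBipartition⇒bipartition : CompleteBipartition G s → Bipartition G s
    completeBipartition⇒bipartition (completeBipartition adj≡xor) {u} {v} uv =
      T-xor⇒≢ (subst T (adj≡xor u v) uv)

    completeBipartition⇒adjacent : CompleteBipartition G s → ∀ {u v} → s u ≢ s v → Adj G u v
    completeBipartition⇒adjacent (completeBipartition adj≡xor) {u} {v} su≢sv =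
      subst T (≡.sym (adj≡xor u v)) (≢⇒T-xor su≢sv)

    bipartition⇒completeBipartition : Bipartition G s → (∀ {u v} → s u ≢ s v → Adj G u v) →
                                      CompleteBipartition G s
    bipartition⇒completeBipartition bip across = completeBipartition λ u v → ⇔→≡ (mk⇔
      (λ e → Equivalence.to T-≡ (≢⇒T-xor (bip (Equivalence.from T-≡ e))))
      (λ e → Equivalence.to T-≡ (across (T-xor⇒≢ (Equivalence.from T-≡ e)))))

    completeBipartition-xor : CompleteBipartition G s → ∀ b → CompleteBipartition G (λ u → s u xor b)
    completeBipartition-xor (completeBipartition adj≡xor) b =
      completeBipartition λ u v → trans (adj≡xor u v) (≡.sym (xor-cancelʳ (s u) (s v) b))

  proper⇒bipartition : ∀ {c : V G → Fin 2} → Proper G c → Bipartition G (Inverse.to 2↔Bool ∘ c)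
  proper⇒bipartition {c} proper {u} {v} uv e =
    proper u v uv (trans (≡.sym (strictlyInverseʳ (c u))) (trans (cong from e) (strictlyInverseʳ (c v))))
    where open Inverse 2↔Bool

  bipartition⇒proper : ∀ {s : V G → Bool} → Bipartition G s → Proper G (Inverse.from 2↔Bool ∘ s)
  bipartition⇒proper {s} bip u v uv e =
    bip uv (trans (≡.sym (strictlyInverseˡ (s u))) (trans (cong to e) (strictlyInverseˡ (s v))))
    where open Inverse 2↔Bool

  module _ {k : ℕ} {c : V G → Fin k} where

    partialGrundy : Proper G c → (∀ i → ∃ λ v → c v ≡ i × GrundyVertex G c v) → HasPartialGrundy G k
    partialGrundy proper grundy =
      c , (λ i → proj₁ (grundy i) , proj₁ (proj₂ (grundy i))) , proper , grundy

    grundyVertexOfColour : ∀ {i} v → c v ≡ i → (∀ j → j Fin.< i → ∃ λ u → Adj G v u × c u ≡ j) →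
                           ∃ λ v → c v ≡ i × GrundyVertex G c v
    grundyVertexOfColour v refl neighbours = v , refl , neighbours

    neighbourOfColour : ∀ {v i} j → GrundyVertex G c v → c v ≡ i → j Fin.< i →
                        ∃ λ u → Adj G v u × c u ≡ j
    neighbourOfColour j grundy refl j<i = grundy j j<i

  partialGrundyNumber≤ : ∀ {m} → (∀ {k} → suc m ≤ k → ¬ HasPartialGrundy G k) →
                         ∀ k → HasPartialGrundy G k → k ≤ m
  partialGrundyNumber≤ {m} none k h with k ≤? m
  ... | yes k≤m = k≤m
  ... | no  k≰m = ⊥-elim (none (≰⇒> k≰m) h)

  module _ {s : V G → Bool} (bip : Bipartition G s) where

    edge⇒partialGrundy₂ : ∀ {p q} → Adj G p q → s p ≡ false → s q ≡ true → HasPartialGrundy G 2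
    edge⇒partialGrundy₂ {p} {q} pq sp sq = partialGrundy (bipartition⇒proper bip) λ where
        0F → grundyVertexOfColour p (cong from sp) λ _ ()
        1F → grundyVertexOfColour q (cong from sq) λ where
               0F _ → p , adjSym pq , cong from sp
               1F (s≤s ())
      where open Inverse 2↔Bool

    bipartition⇒partialGrundy₂ : ∀ {p q} → Adj G p q → HasPartialGrundy G 2
    bipartition⇒partialGrundy₂ {p} {q} pq with s p in sp
    ... | false = edge⇒partialGrundy₂ pq sp (trans (¬-not (bip (adjSym pq))) (cong not sp))
    ... | true  = edge⇒partialGrundy₂ (adjSym pq) (trans (¬-not (bip (adjSym pq))) (cong not sp)) sp

  completeBipartition⇒noPartialGrundy₃ : ∀ {s} → CompleteBipartition G s →
                                         ∀ {k} → 3 ≤ k → ¬ HasPartialGrundy G k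
  completeBipartition⇒noPartialGrundy₃ {s} cb (s≤s (s≤s (s≤s _))) (c , _ , proper , grundy)
    with grundy 2F | grundy 1F
  ... | v , cv , gv | u , cu , gu
    with neighbourOfColour 0F gv cv z<s | neighbourOfColour 1F gv cv (s<s z<s)
       | neighbourOfColour 0F gu cu z<s
  ... | x , vx , cx | y , vy , cy | w , uw , cw = by-side (s u Bool.≟ s v)
    where
    bip : Bipartition G s
    bip = completeBipartition⇒bipartition cb
    across : ∀ {p q} → s p ≢ s q → Adj G p q
    across = completeBipartition⇒adjacent cb
    by-side : Dec (s u ≡ s v) → ⊥
    by-side (yes su≡sv) =
      proper u y (across λ su≡sy → bip vy (trans (≡.sym su≡sv) su≡sy)) (trans cu (≡.sym cy))
    by-side (no su≢sv) =
      proper w x (across λ sw≡sx → bip vx (trans (≡.sym sw≡sv) sw≡sx)) (trans cw (≡.sym cx))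
      where
      sw≡sv : s w ≡ s v
      sw≡sv = ≢-≢⇒≡ (bip uw ∘ ≡.sym) (su≢sv ∘ ≡.sym)

  atMostOneNeighbour⇒noPartialGrundy₃ : AtMostOneNeighbour G → ∀ {k} → 3 ≤ k → ¬ HasPartialGrundy G k
  atMostOneNeighbour⇒noPartialGrundy₃ one (s≤s (s≤s (s≤s _))) (c , _ , _ , grundy) with grundy 2F
  ... | v , cv , gv with neighbourOfColour 0F gv cv z<s | neighbourOfColour 1F gv cv (s<s z<s)
  ... | x , vx , cx | y , vy , cy = 0≢1+n (trans (≡.sym cx) (trans (cong c (one vx vy)) cy))

  -- With colours counted from 0: x gets 0, the rest of x's side 1, the neighbours of x 2 and all
  -- other vertices 0.  Then v is a Grundy vertex of colour 2 (via x and y), z one of colour 1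
  -- (via w, which is not adjacent to x) and x one of colour 0.
  module PartialGrundy₃ {s : V G → Bool} (bip : Bipartition G s) {v x y w z : V G}
    (vx : Adj G v x) (vy : Adj G v y) (x≢y : x ≢ y)
    (sw≡sv : s w ≡ s v) (wz : Adj G w z) (w≁x : ¬ Adj G w x) where

    pick : (sameSide isX adjacent : Bool) → Fin 3
    pick true  true  _     = 0F
    pick true  false _     = 1F
    pick false _     true  = 2F
    pick false _     false = 0F

    colour : V G → Fin 3
    colour p = pick (does (s p Bool.≟ s x)) (does (p Fin.≟ x)) (adj G p x)

    colour-x : colour x ≡ 0F
    colour-x rewrite dec-true (s x Bool.≟ s x) refl | dec-true (x Fin.≟ x) refl = refl

    colour-sameSide : ∀ {p} → s p ≡ s x → p ≢ x → colour p ≡ 1F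
    colour-sameSide {p} sp≡sx p≢x
      rewrite dec-true (s p Bool.≟ s x) sp≡sx | dec-false (p Fin.≟ x) p≢x = refl

    colour-adjacent : ∀ {p} → Adj G p x → colour p ≡ 2F
    colour-adjacent {p} px with adj G p x | px
    ... | true | _ rewrite dec-false (s p Bool.≟ s x) (bip px) = refl

    colour-far : ∀ {p} → s p ≢ s x → ¬ Adj G p x → colour p ≡ 0F
    colour-far {p} sp≢sx p≁x with adj G p x | p≁x
    ... | false | _    rewrite dec-false (s p Bool.≟ s x) sp≢sx = refl
    ... | true  | p≁x′ = ⊥-elim (p≁x′ _)

    sx≢sv : s x ≢ s v
    sx≢sv = bip (adjSym vx)

    proper-from-x-side : ∀ {p q} → Adj G p q → s p ≡ s x → colour p ≢ colour q
    proper-from-x-side {p} {q} pq sp≡sx = by-cases (p Fin.≟ x) (T? (adj G q x))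
      where
      by-cases : Dec (p ≡ x) → Dec (Adj G q x) → colour p ≢ colour q
      by-cases (yes p≡x) _ =
        subst₂ _≢_ (≡.sym (trans (cong colour p≡x) colour-x))
                   (≡.sym (colour-adjacent (subst (Adj G q) p≡x (adjSym pq)))) λ ()
      by-cases (no p≢x) (yes qx) =
        subst₂ _≢_ (≡.sym (colour-sameSide sp≡sx p≢x)) (≡.sym (colour-adjacent qx)) λ ()
      by-cases (no p≢x) (no q≁x) =
        subst₂ _≢_ (≡.sym (colour-sameSide sp≡sx p≢x)) (≡.sym (colour-far sq≢sx q≁x)) λ ()
        where
        sq≢sx : s q ≢ s x
        sq≢sx sq≡sx = bip pq (trans sp≡sx (≡.sym sq≡sx))

    proper : Proper G colour
    proper p q pq = by-side (s p Bool.≟ s x)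
      where
      by-side : Dec (s p ≡ s x) → colour p ≢ colour q
      by-side (yes sp≡sx) = proper-from-x-side pq sp≡sx
      by-side (no  sp≢sx) =
        proper-from-x-side (adjSym pq) (≢-≢⇒≡ (bip (adjSym pq)) (sp≢sx ∘ ≡.sym)) ∘ ≡.sym

    partialGrundy₃ : HasPartialGrundy G 3
    partialGrundy₃ = partialGrundy proper λ where
        0F → grundyVertexOfColour x colour-x λ _ ()
        1F → grundyVertexOfColour z colour-z λ where
               0F _ → w , adjSym wz , colour-far (λ sw≡sx → sx≢sv (trans (≡.sym sw≡sx) sw≡sv)) w≁x
               1F (s≤s ())
        2F → grundyVertexOfColour v (colour-adjacent vx) λ where
               0F _ → x , vx , colour-x
               1F _ → y , vy , colour-sameSide (≢-≢⇒≡ (bip (adjSym vy)) sx≢sv) (x≢y ∘ ≡.sym)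
               2F (s≤s (s≤s ()))
      where
      colour-z : colour z ≡ 1F
      colour-z = colour-sameSide (≢-≢⇒≡ sz≢sv sx≢sv) λ { refl → w≁x wz }
        where
        sz≢sv : s z ≢ s v
        sz≢sv sz≡sv = bip (adjSym wz) (trans sz≡sv (≡.sym sw≡sv))

  module _ {s : V G → Bool} (bip : Bipartition G s) (noIsolated : NoIsolated G)
           (no₃ : ¬ HasPartialGrundy G 3) where

    sameSide⇒adjacent : ∀ {v x y w} → Adj G v x → Adj G v y → x ≢ y → s w ≡ s v → Adj G w x
    sameSide⇒adjacent {x = x} {w = w} vx vy x≢y sw≡sv with T? (adj G w x)
    ... | yes wx  = wx
    ... | no  w≁x =
      ⊥-elim (no₃ (PartialGrundy₃.partialGrundy₃ bip vx vy x≢y sw≡sv (proj₂ (noIsolated w)) w≁x))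

    -- q has a neighbour w₁ on v's side; w₁ is adjacent to x as well, so w₁ has two neighbours.
    oppositeSides⇒adjacent : ∀ {v x y w q} → Adj G v x → Adj G v y → x ≢ y →
                             s w ≡ s v → s q ≢ s v → Adj G w q
    oppositeSides⇒adjacent {v} {x} {y} {w} {q} vx vy x≢y sw≡sv sq≢sv with q Fin.≟ x | noIsolated q
    ... | yes refl | _        = sameSide⇒adjacent vx vy x≢y sw≡sv
    ... | no  q≢x  | w₁ , qw₁ =
      sameSide⇒adjacent (adjSym qw₁) (sameSide⇒adjacent vx vy x≢y sw₁≡sv) q≢x
                        (trans sw≡sv (≡.sym sw₁≡sv))
      where
      sw₁≡sv : s w₁ ≡ s v
      sw₁≡sv = ≢-≢⇒≡ (bip (adjSym qw₁)) (sq≢sv ∘ ≡.sym)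

    twoNeighbours⇒completeBipartition : ∀ {v x y} → Adj G v x → Adj G v y → x ≢ y →
                                        CompleteBipartition G s
    twoNeighbours⇒completeBipartition {v} vx vy x≢y = bipartition⇒completeBipartition bip across
      where
      across : ∀ {p q} → s p ≢ s q → Adj G p q
      across {p} {q} sp≢sq with s p Bool.≟ s v
      ... | yes sp≡sv = oppositeSides⇒adjacent vx vy x≢y sp≡sv (sp≢sq ∘ trans sp≡sv ∘ ≡.sym)
      ... | no  sp≢sv =
        adjSym (oppositeSides⇒adjacent vx vy x≢y (≢-≢⇒≡ (sp≢sq ∘ ≡.sym) (sp≢sv ∘ ≡.sym)) sp≢sv)

  twoNeighbours⊎atMostOneNeighbour :
    (∃ λ v → ∃₂ λ x y → Adj G v x × Adj G v y × x ≢ y) ⊎ AtMostOneNeighbour G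
  twoNeighbours⊎atMostOneNeighbour
    with any? (λ v → any? (λ x → any? (λ y → T? (adj G v x) ×-dec T? (adj G v y) ×-dec ¬? (x Fin.≟ y))))
  ... | yes found = inj₁ found
  ... | no  none  = inj₂ λ {v} {x} {y} vx vy →
    decidable-stable (x Fin.≟ y) λ x≢y → none (v , x , y , vx , vy , x≢y)

  everyComponentK2⇒atMostOneNeighbour : EveryComponentK2 G → AtMostOneNeighbour G
  everyComponentK2⇒atMostOneNeighbour k2 vx vy = trans (isPartner vx) (≡.sym (isPartner vy))
    where
    isPartner : ∀ {v x} → Adj G v x → x ≡ proj₁ (k2 v)
    isPartner {v} vx with proj₂ (proj₂ (k2 v)) _ (vx ◅ ε)
    ... | inj₁ x≡v = ⊥-elim (adj⇒≢ vx (≡.sym x≡v))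
    ... | inj₂ x≡u = x≡u

  atMostOneNeighbour⇒everyComponentK2 : NoIsolated G → AtMostOneNeighbour G → EveryComponentK2 G
  atMostOneNeighbour⇒everyComponentK2 noIsolated one v = u , vu , λ w path → closed path (inj₁ refl)
    where
    u : V G
    u = proj₁ (noIsolated v)
    vu : Adj G v u
    vu = proj₂ (noIsolated v)
    step : ∀ {w z} → Adj G w z → w ≡ v ⊎ w ≡ u → z ≡ v ⊎ z ≡ u
    step wz (inj₁ refl) = inj₂ (one wz vu)
    step wz (inj₂ refl) = inj₁ (one wz (adjSym vu))
    closed : ∀ {w z} → Reach G w z → w ≡ v ⊎ w ≡ u → z ≡ v ⊎ z ≡ u
    closed ε          inside = inside
    closed (wz ◅ path) inside = closed path (step wz inside)

  atMostOneNeighbour⇒bipartition : NoIsolated G → AtMostOneNeighbour G → ∃ (Bipartition G)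
  atMostOneNeighbour⇒bipartition noIsolated one = smallerEnd , separates
    where
    smallerEnd : V G → Bool
    smallerEnd v = toℕ v <ᵇ toℕ (proj₁ (noIsolated v))
    separates : Bipartition G smallerEnd
    separates {p} {q} pq
      rewrite one (proj₂ (noIsolated p)) pq | one (proj₂ (noIsolated q)) (adjSym pq)
      = ≢⇒<ᵇ-flip (adj⇒≢ pq ∘ toℕ-injective)

  ≅⇒completeBipartition : ∀ {a b} (iso : G ≅ CompleteBipartite a b) →
                          CompleteBipartition G (side {a} {b} ∘ Bijection.to (proj₁ iso))
  ≅⇒completeBipartition {a} {b} (_ , adj≡) =
    completeBipartition λ u v → trans (adj≡ u v) (completeBipartite-adj {a} {b} _ _)

  completeBipartition⇒≅ : ∀ {s} → CompleteBipartition G s →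
    ∃₂ λ a b → Σ (G ≅ CompleteBipartite a b) λ iso → ∀ v → side {a} {b} (Bijection.to (proj₁ iso) v) ≡ s v
  completeBipartition⇒≅ {s} (completeBipartition adj≡xor) with sortBySide s
  ... | a , b , π , sides = a , b , (↔⇒⤖ π , adj≡) , sides
    where
    adj≡ : ∀ u v → adj G u v ≡ adj (CompleteBipartite a b) (π ⟨$⟩ʳ u) (π ⟨$⟩ʳ v)
    adj≡ u v = trans (adj≡xor u v)
      (≡.sym (trans (completeBipartite-adj {a} {b} _ _) (cong₂ _xor_ (sides u) (sides v))))

  -- Reorienting by v's side puts x and y on the first side of K_{a,b} and v on the second.
  twoNeighbours⇒≅CompleteBipartite : ∀ {s} → CompleteBipartition G s → ∀ {v x y} →
    Adj G v x → Adj G v y → x ≢ y → ∃₂ λ a b → 2 ≤ a × 1 ≤ b × G ≅ CompleteBipartite a b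
  twoNeighbours⇒≅CompleteBipartite {s} cb {v} {x} {y} vx vy x≢y
    with completeBipartition⇒≅ (completeBipartition-xor cb (s v))
  ... | a , b , iso , sides =
    a , b , distinct-<⇒2≤ (firstSide vx) (firstSide vy) (x≢y ∘ Bijection.injective (proj₁ iso) ∘ toℕ-injective) ,
    side≡false⇒1≤b {a} _ (trans (sides v) (xor-same (s v))) , iso
    where
    firstSide : ∀ {u} → Adj G v u → toℕ (Bijection.to (proj₁ iso) u) ℕ.< a
    firstSide {u} vu =
      side≡true⇒< {a} {b} _ (trans (sides u) (≢⇒xor≡true (completeBipartition⇒bipartition cb vu ∘ ≡.sym)))

mainTheorem10 : (G : Graph) → 1 ≤ n G → NoIsolated G →
    (PartialGrundyNumberIs G 2 ⇔
      ((∃ λ (a : ℕ) → ∃ λ (b : ℕ) → 2 ≤ a × 1 ≤ b × G ≅ CompleteBipartite a b)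
        ⊎ EveryComponentK2 G))
mainTheorem10 G 1≤n noIsolated = mk⇔
  (λ ((c , _ , proper , _) , maximal) →
     Sum.map (λ (_ , _ , _ , vx , vy , x≢y) →
                twoNeighbours⇒≅CompleteBipartite
                  (twoNeighbours⇒completeBipartition (proper⇒bipartition proper) noIsolated
                     (3≰2 ∘ maximal 3) vx vy x≢y)
                  vx vy x≢y)
             (atMostOneNeighbour⇒everyComponentK2 noIsolated)
             twoNeighbours⊎atMostOneNeighbour)
  λ where
    (inj₁ (a , b , _ , _ , iso)) → ofCompleteBipartition (≅⇒completeBipartition {a = a} {b} iso)
    (inj₂ k2)                    → ofAtMostOneNeighbour (everyComponentK2⇒atMostOneNeighbour k2)
  where
  open Properties {G = G}

  3≰2 : ¬ 3 ≤ 2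
  3≰2 (s≤s (s≤s ()))

  partialGrundyNumber2 : ∀ {s} → Bipartition G s → (∀ {k} → 3 ≤ k → ¬ HasPartialGrundy G k) →
                         PartialGrundyNumberIs G 2
  partialGrundyNumber2 bip none =
    bipartition⇒partialGrundy₂ bip (proj₂ (noIsolated (fromℕ< 1≤n))) , partialGrundyNumber≤ none

  ofCompleteBipartition : ∀ {s} → CompleteBipartition G s → PartialGrundyNumberIs G 2
  ofCompleteBipartition cb =
    partialGrundyNumber2 (completeBipartition⇒bipartition cb) (completeBipartition⇒noPartialGrundy₃ cb)

  ofAtMostOneNeighbour : AtMostOneNeighbour G → PartialGrundyNumberIs G 2
  ofAtMostOneNeighbour one =
    partialGrundyNumber2 (proj₂ (atMostOneNeighbour⇒bipartition noIsolated one))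
                         (atMostOneNeighbour⇒noPartialGrundy₃ one)
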